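{- Let $\epsilon_n$ denote the number of skew-symmetric $(n,n)$-clans whose base clan is $\underbrace{ -\cdots- }_{n}\underbrace{+\cdots+}_{n}$. Then $$\epsilon_n=\sum_{k=0}^{n}\ \sum_{\substack{\alpha,\beta\ge 0\\ 2\alpha+\beta=k}}\binom{n}{\beta}\binom{n-\beta}{2\alpha}\frac{(2\alpha)!}{2^\alpha\alpha!}=\sum_{k=0}^{n}\ \sum_{\substack{\alpha,\beta\ge0\\ 2\alpha+\beta=k}}\binom{n}{\beta}\frac{(n-\beta)!}{(n-\beta-2\alpha)!\,2^\alpha\alpha!}.$$
   Context: An $(n,n)$-clan is a string $\gamma=c_1\cdots c_{2n}$ of symbols from $\mathbb{N}\cup\{+,-\}$ such that each natural number appearing appears exactly twice and the numbers of $+$'s and $-$'s are equal; clans are equal if they have the same $\pm$ symbols in the same positions and the same sets of positions of matching pairs. $\gamma$ is skew-symmetric if $\gamma=-rev(\gamma)$, where $rev$ reverses the string and $-$ interchanges $+$ and $-$. The base clan of $\gamma$ is obtained by replacing, for each matching pair $c_i=c_j\in\mathbb N$ with $i<j$, the symbol $c_i$ by $-$ and $c_j$ by $+$. -}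

module Defs where

open import Data.Bool using (Bool; true; false; _∧_; not; if_then_else_; T)
open import Data.Nat using (ℕ; zero; suc; _+_; _*_; _∸_; _^_; _≡ᵇ_; _<ᵇ_; _/_)
open import Data.Nat.Properties using (m*n≢0; m^n≢0; _!≢0)
open import Data.Nat.Combinatorics using (_C_)
open import Data.Nat.Base using (_!)
open import Data.Fin using (Fin; toℕ; opposite; _≟_)
open import Data.Vec using (Vec; []; _∷_; lookup)
open import Data.List using (List; allFin; map; upTo)
open import Data.Bool.ListAction using (all)
open import Data.Nat.ListAction using (sum)
open import Data.Product using (Σ)
open import Relation.Nullary.Decidable using (isYes)

-- A symbol of a clan of length m, in canonical form: a sign, or a
-- natural-number symbol, recorded by the position of its (unique) partner.
data Sym (m : ℕ) : Set where
  plus  : Sym m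
  minus : Sym m
  pair  : Fin m → Sym m

_==_ : {m : ℕ} → Sym m → Sym m → Bool
plus   == plus   = true
minus  == minus  = true
pair i == pair j = isYes (i ≟ j)
_      == _      = false

countSym : {m k : ℕ} → Sym m → Vec (Sym m) k → ℕ
countSym s []       = 0
countSym s (t ∷ ts) = (if s == t then 1 else 0) + countSym s ts

-- Two clans are equal in the paper's sense iff they
-- have the same signs in the same positions and the same matching pairs,
-- i.e. iff their canonical vectors are equal.
isClan : {m : ℕ} → Vec (Sym m) m → Bool
isClan {m} c = all ok (allFin m) ∧ (countSym plus c ≡ᵇ countSym minus c)
  where
    ok : Fin m → Bool
    ok i with lookup c i
    ... | plus   = true
    ... | minus  = true
    ... | pair j = not (isYes (i ≟ j)) ∧ (lookup c j == pair i)

-- The symbol at position i of -rev(γ), computed from γ's symbol at the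
-- mirrored position: signs are interchanged, a matching pair {a,b}
-- becomes {rev a, rev b}.
negRev : {m : ℕ} → Sym m → Sym m
negRev plus     = minus
negRev minus    = plus
negRev (pair j) = pair (opposite j)

isSkewSymmetric : {m : ℕ} → Vec (Sym m) m → Bool
isSkewSymmetric {m} c =
  all (λ i → lookup c i == negRev (lookup c (opposite i))) (allFin m)

baseSym : {m : ℕ} → Vec (Sym m) m → Fin m → Sym m
baseSym c i with lookup c i
... | plus   = plus
... | minus  = minus
... | pair j = if toℕ i <ᵇ toℕ j then minus else plus

standardBase : (n : ℕ) → Fin (n + n) → Sym (n + n)
standardBase n i = if toℕ i <ᵇ n then minus else plus

hasStandardBase : (n : ℕ) → Vec (Sym (n + n)) (n + n) → Bool
hasStandardBase n c = all (λ i → baseSym c i == standardBase n i) (allFin (n + n))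

SkewClan : ℕ → Set
SkewClan n = Σ (Vec (Sym (n + n)) (n + n))
  (λ c → T (isClan c ∧ isSkewSymmetric c ∧ hasStandardBase n c))

den₁ : ℕ → ℕ
den₁ α = 2 ^ α * α !

den₂ : ℕ → ℕ → ℕ → ℕ
den₂ n α β = (n ∸ β ∸ 2 * α) ! * (2 ^ α * α !)

term₁ : ℕ → ℕ → ℕ → ℕ
term₁ n α β =
  (n C β) * ((n ∸ β) C (2 * α)) *
  ((2 * α) ! / den₁ α) {{m*n≢0 (2 ^ α) (α !) {{m^n≢0 2 α}} {{α !≢0}}}}

term₂ : ℕ → ℕ → ℕ → ℕ
term₂ n α β =
  (n C β) *
  ((n ∸ β) ! / den₂ n α β)
    {{m*n≢0 ((n ∸ β ∸ 2 * α) !) (2 ^ α * α !) {{(n ∸ β ∸ 2 * α) !≢0}}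
        {{m*n≢0 (2 ^ α) (α !) {{m^n≢0 2 α}} {{α !≢0}}}}}}

-- Σ_{k=0}^{n} Σ_{α,β ≥ 0, 2α+β = k} f α β
-- (α, β range over 0..k, which contains all solutions of 2α+β = k)
doubleSum : ℕ → (ℕ → ℕ → ℕ) → ℕ
doubleSum n f =
  sum (map (λ k →
    sum (map (λ α →
      sum (map (λ β → if (2 * α + β) ≡ᵇ k then f α β else 0)
               (upTo (suc k))))
      (upTo (suc k))))
    (upTo (suc n)))

formula₁ : ℕ → ℕ
formula₁ n = doubleSum n (term₁ n)

formula₂ : ℕ → ℕ
formula₂ n = doubleSum n (term₂ n)

-- A skew-symmetric clan with base clan -…-+…+ is determined by its left half, and each
-- position of the left half carries either - or a number shared with a position of the right
-- half, i.e. (after mirroring) with a left position.  So these clans are exactly the partial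
-- involutions σ of n points, where a point may be undefined, fixed, or swapped with another.
-- Looking at the first point gives a(n+2) = 2 a(n+1) + (n+1) a(n).  The summand
-- C(n,β) C(n-β,2α) (2α-1)!! counts the σ with β fixed points and α 2-cycles, and Pascal's rule
-- together with absorption shows that its sum over α, β obeys the same recurrence.

module Submission where

open import Defs
open import Data.Bool using (Bool; true; false; T; _∧_; if_then_else_)
open import Data.Bool.Properties using (T-≡; T-∧; T-irrelevant)
open import Data.Bool.ListAction using (all)
open import Data.Nat using (ℕ; zero; suc; _+_; _*_; _∸_; _^_; _≤_; _<_; z≤n; s≤s; _≡ᵇ_; _<ᵇ_; NonZero; _!; _/_)
open import Data.Nat.Properties hiding (_≟_; suc-injective)
open import Data.Nat.Combinatorics using (_C_; nCk+nC[k+1]≡[n+1]C[k+1]; nCk≡n!/k![n-k]!; k![n∸k]!∣n!)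
open import Data.Nat.DivMod using (m*n/n≡m; m*[n/m]≡n; /-congˡ)
open import Data.Nat.ListAction using (sum)
open import Data.Nat.Solver using (module +-*-Solver)
open import Data.Fin using (Fin; zero; suc; toℕ; opposite; _≟_; _↑ˡ_; _↑ʳ_; splitAt; join; fromℕ; inject₁; punchIn; punchOut)
open import Data.Fin.Properties using (toℕ-injective; opposite-prop; opposite-involutive; toℕ-↑ˡ; toℕ-↑ʳ; toℕ<n; splitAt-↑ʳ; join-splitAt; punchInᵢ≢i; punchOut-cong; punchIn-punchOut; punchOut-punchIn; suc-injective; +↔⊎; *↔×; 0↔⊥)
open import Data.Vec using (Vec; []; _∷_; lookup; map; tail; tabulate; insertAt; removeAt; _++_; _∷ʳ_; reverse)
open import Data.Vec.Properties using (lookup-map; lookup-++ˡ; lookup-++ʳ; lookup∘tabulate; tabulate∘lookup; tabulate-cong; reverse-∷; insertAt-lookup; insertAt-punchIn; removeAt-insertAt; insertAt-removeAt; removeAt-punchOut)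
open import Data.Maybe using (Maybe; just; nothing)
import Data.Maybe as Maybe
open import Data.Maybe.Properties using (just-injective; ≡-dec)
open import Data.List using (allFin; applyUpTo; upTo)
import Data.List as List
import Data.List.Relation.Unary.All as All
open import Data.List.Relation.Unary.All.Properties using (all⁺; all⁻)
open import Data.List.Membership.Propositional.Properties using (∈-allFin)
open import Data.Product using (Σ; _×_; _,_; proj₁; proj₂)
open import Data.Sum using (_⊎_; inj₁; inj₂)
open import Data.Empty using (⊥; ⊥-elim)
open import Function using (_∘_; id)
open import Function.Bundles using (Equivalence; _↔_; mk↔ₛ′)
open import Function.Properties.Inverse using (↔-trans; ↔-sym; ↔-refl)
open import Data.Sum.Function.Propositional using (_⊎-↔_)
open import Data.Product.Function.NonDependent.Propositional using (_×-↔_)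
open import Relation.Binary.PropositionalEquality
open import Relation.Nullary using (yes; no; ¬_)
open import Relation.Nullary.Decidable using (isYes; toWitness; fromWitness; fromWitnessFalse)
open +-*-Solver using (solve; _:+_; _:*_; _:=_; con)

when : Bool → ℕ → ℕ
when b c = if b then c else 0

Vec-≡ : ∀ {A : Set} {n} {xs ys : Vec A n} → (∀ i → lookup xs i ≡ lookup ys i) → xs ≡ ys
Vec-≡ {xs = xs} {ys} eq = trans (sym (tabulate∘lookup xs)) (trans (tabulate-cong eq) (tabulate∘lookup ys))

Σ-T-≡ : ∀ {A : Set} (P : A → Bool) {x y : A} {p : T (P x)} {q : T (P y)} →
  x ≡ y → _≡_ {A = Σ A (T ∘ P)} (x , p) (y , q)
Σ-T-≡ P refl = cong (_ ,_) (T-irrelevant _ _)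

all-allFin⁺ : ∀ {m} (p : Fin m → Bool) → T (all p (allFin m)) → ∀ i → T (p i)
all-allFin⁺ {m} p t i = All.lookup (all⁺ p (allFin m) t) (∈-allFin i)

all-allFin⁻ : ∀ {m} (p : Fin m → Bool) → (∀ i → T (p i)) → T (all p (allFin m))
all-allFin⁻ {m} p h = all⁻ p {allFin m} (All.tabulate (λ {i} _ → h i))

-- Partial involutions

-- lookup v i ≡ just j encodes σ i = j.
PartialMap : ℕ → Set
PartialMap m = Vec (Maybe (Fin m)) m

IsInvolutive : ∀ {m} → PartialMap m → Set
IsInvolutive v = ∀ i j → lookup v i ≡ just j → lookup v j ≡ just i

pointsBack : ∀ {m} → PartialMap m → Fin m → Maybe (Fin m) → Bool
pointsBack v i nothing  = true
pointsBack v i (just j) = isYes (≡-dec _≟_ (lookup v j) (just i))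

-- Boolean, so that by T-irrelevant two partial involutions are equal when their maps are.
isInvolutive : ∀ {m} → PartialMap m → Bool
isInvolutive {m} v = all (λ i → pointsBack v i (lookup v i)) (allFin m)

PartialInvolution : ℕ → Set
PartialInvolution m = Σ (PartialMap m) (T ∘ isInvolutive)

isInvolutive⇒IsInvolutive : ∀ {m} (v : PartialMap m) → T (isInvolutive v) → IsInvolutive v
isInvolutive⇒IsInvolutive v t i j vi≡j =
  toWitness (subst (T ∘ pointsBack v i) vi≡j (all-allFin⁺ (λ i → pointsBack v i (lookup v i)) t i))

IsInvolutive⇒isInvolutive : ∀ {m} (v : PartialMap m) → IsInvolutive v → T (isInvolutive v)
IsInvolutive⇒isInvolutive v inv = all-allFin⁻ _ pointsBackAt
  where
  pointsBackAt : ∀ i → T (pointsBack v i (lookup v i))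
  pointsBackAt i with lookup v i in vi≡
  ... | nothing = _
  ... | just j  = fromWitness (inv i j vi≡)

raise : ∀ {m} → Maybe (Fin m) → Maybe (Fin (suc m))
raise = Maybe.map suc

lower : ∀ {m} → Maybe (Fin (suc m)) → Maybe (Fin m)
lower nothing         = nothing
lower (just zero)     = nothing
lower (just (suc j))  = just j

lower-raise : ∀ {m} (y : Maybe (Fin m)) → lower (raise y) ≡ y
lower-raise nothing  = refl
lower-raise (just j) = refl

raise-lower : ∀ {m} (y : Maybe (Fin (suc m))) → y ≢ just zero → raise (lower y) ≡ y
raise-lower nothing        _   = refl
raise-lower (just zero)    y≢0 = ⊥-elim (y≢0 refl)
raise-lower (just (suc j)) _   = refl

data Fixed {m} : Maybe (Fin (suc m)) → Set where
  unmatched   : Fixed nothing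
  selfMatched : Fixed (just zero)

IsInvolutive-lower : ∀ {m} x (w : Vec (Maybe (Fin (suc m))) m) → IsInvolutive (x ∷ w) → IsInvolutive (map lower w)
IsInvolutive-lower x w inv i j wi≡j rewrite lookup-map j lower w =
  cong lower (inv (suc i) (suc j) (lower≡just (trans (sym (lookup-map i lower w)) wi≡j)))
  where
  lower≡just : ∀ {y j} → lower y ≡ just j → y ≡ just (suc j)
  lower≡just {just (suc j)} refl = refl

IsInvolutive-raise : ∀ {m} {x} → Fixed x → (u : PartialMap m) → IsInvolutive u → IsInvolutive (x ∷ map raise u)
IsInvolutive-raise selfMatched u inv zero .zero refl = refl
IsInvolutive-raise _ u inv (suc i) j ui≡j with lookup u i in ui≡ | trans (sym (lookup-map i raise u)) ui≡j
... | just j′ | refl = trans (lookup-map j′ raise u) (cong raise (inv i j′ ui≡))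

Fixed⇒unpartnered : ∀ {m} {x} → Fixed x → (w : Vec (Maybe (Fin (suc m))) m) → IsInvolutive (x ∷ w) →
  ∀ i → lookup w i ≢ just zero
Fixed⇒unpartnered unmatched   w inv i wi≡0 with inv (suc i) zero wi≡0
... | ()
Fixed⇒unpartnered selfMatched w inv i wi≡0 with inv (suc i) zero wi≡0
... | ()

map-raise-lower : ∀ {m} {x} → Fixed x → (w : Vec (Maybe (Fin (suc m))) m) → IsInvolutive (x ∷ w) → map raise (map lower w) ≡ w
map-raise-lower fixed w inv = Vec-≡ λ i →
  trans (lookup-map i raise (map lower w))
    (trans (cong raise (lookup-map i lower w)) (raise-lower _ (Fixed⇒unpartnered fixed w inv i)))

map-lower-raise : ∀ {m n} (u : Vec (Maybe (Fin m)) n) → map lower (map raise u) ≡ u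
map-lower-raise []      = refl
map-lower-raise (y ∷ u) = cong₂ _∷_ (lower-raise y) (map-lower-raise u)

raiseAround : ∀ {m} → Fin (suc m) → Maybe (Fin m) → Maybe (Fin (suc (suc m)))
raiseAround k = Maybe.map (suc ∘ punchIn k)

lowerAround : ∀ {m} → Fin (suc m) → Maybe (Fin (suc (suc m))) → Maybe (Fin m)
lowerAround k nothing        = nothing
lowerAround k (just zero)    = nothing
lowerAround k (just (suc j)) with k ≟ j
... | yes _   = nothing
... | no  k≢j = just (punchOut k≢j)

lowerAround-raiseAround : ∀ {m} (k : Fin (suc m)) y → lowerAround k (raiseAround k y) ≡ y
lowerAround-raiseAround k nothing  = refl
lowerAround-raiseAround k (just j) with k ≟ punchIn k j
... | yes k≡ = ⊥-elim (punchInᵢ≢i k j (sym k≡))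
... | no  k≢ = cong just (trans (punchOut-cong k refl) (punchOut-punchIn k))

raiseAround-lowerAround : ∀ {m} (k : Fin (suc m)) y → y ≢ just zero → y ≢ just (suc k) →
  raiseAround k (lowerAround k y) ≡ y
raiseAround-lowerAround k nothing        _   _    = refl
raiseAround-lowerAround k (just zero)    y≢0 _    = ⊥-elim (y≢0 refl)
raiseAround-lowerAround k (just (suc j)) _   y≢1+k with k ≟ j
... | yes refl = ⊥-elim (y≢1+k refl)
... | no  k≢j  = cong (just ∘ suc) (punchIn-punchOut k≢j)

lowerAround≡just : ∀ {m} (k : Fin (suc m)) y j → lowerAround k y ≡ just j → y ≡ just (suc (punchIn k j))
lowerAround≡just k (just (suc j₀)) j eq with k ≟ j₀
lowerAround≡just k (just (suc j₀)) .(punchOut k≢j₀) refl | no k≢j₀ = cong (just ∘ suc) (sym (punchIn-punchOut k≢j₀))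

raiseAround≡just : ∀ {m} (k : Fin (suc m)) y j → raiseAround k y ≡ just j → Σ (Fin m) (λ j′ → y ≡ just j′ × j ≡ suc (punchIn k j′))
raiseAround≡just k (just j′) .(suc (punchIn k j′)) refl = j′ , refl , refl

map-lowerAround-raiseAround : ∀ {m n} (k : Fin (suc m)) (u : Vec (Maybe (Fin m)) n) →
  map (lowerAround k) (map (raiseAround k) u) ≡ u
map-lowerAround-raiseAround k []      = refl
map-lowerAround-raiseAround k (y ∷ u) = cong₂ _∷_ (lowerAround-raiseAround k y) (map-lowerAround-raiseAround k u)

lookup-removeAt : ∀ {A : Set} {n} (w : Vec A (suc n)) k i → lookup (removeAt w k) i ≡ lookup w (punchIn k i)
lookup-removeAt w k i = trans (cong (lookup (removeAt w k)) (sym (punchOut-punchIn k)))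
  (removeAt-punchOut w (punchInᵢ≢i k i ∘ sym))

insertPair : ∀ {m} → Fin (suc m) → PartialMap m → PartialMap (suc (suc m))
insertPair k u = just (suc k) ∷ insertAt (map (raiseAround k) u) k (just zero)

removePair : ∀ {m} → Fin (suc m) → Vec (Maybe (Fin (suc (suc m)))) (suc m) → PartialMap m
removePair k w = map (lowerAround k) (removeAt w k)

lookup-insertPair-punchIn : ∀ {m} (k : Fin (suc m)) u i → lookup (insertPair k u) (suc (punchIn k i)) ≡ raiseAround k (lookup u i)
lookup-insertPair-punchIn k u i = trans (insertAt-punchIn (map (raiseAround k) u) k (just zero) i) (lookup-map i (raiseAround k) u)

lookup-removePair : ∀ {m} (k : Fin (suc m)) w i → lookup (removePair k w) i ≡ lowerAround k (lookup w (punchIn k i))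
lookup-removePair k w i = trans (lookup-map i (lowerAround k) (removeAt w k)) (cong (lowerAround k) (lookup-removeAt w k i))

IsInvolutive-insertPair : ∀ {m} (k : Fin (suc m)) u → IsInvolutive u → IsInvolutive (insertPair k u)
IsInvolutive-insertPair k u inv zero    .(suc k) refl = insertAt-lookup (map (raiseAround k) u) k (just zero)
IsInvolutive-insertPair k u inv (suc l) j        eq with k ≟ l
... | yes refl with trans (sym eq) (insertAt-lookup (map (raiseAround k) u) k (just zero))
...   | refl = refl
IsInvolutive-insertPair k u inv (suc l) j eq | no k≢l
  with raiseAround≡just k (lookup u (punchOut k≢l)) j
         (trans (sym (lookup-insertPair-punchIn k u (punchOut k≢l))) (subst (λ i → lookup (insertPair k u) (suc i) ≡ just j) (sym (punchIn-punchOut k≢l)) eq))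
... | j′ , uj′ , refl = begin
  lookup (insertPair k u) (suc (punchIn k j′)) ≡⟨ lookup-insertPair-punchIn k u j′ ⟩
  raiseAround k (lookup u j′)                 ≡⟨ cong (raiseAround k) (inv _ j′ uj′) ⟩
  just (suc (punchIn k (punchOut k≢l)))       ≡⟨ cong (just ∘ suc) (punchIn-punchOut k≢l) ⟩
  just (suc l)                                ∎
  where open ≡-Reasoning

IsInvolutive-removePair : ∀ {m} (k : Fin (suc m)) w → IsInvolutive (just (suc k) ∷ w) → IsInvolutive (removePair k w)
IsInvolutive-removePair k w inv i j eq = begin
  lookup (removePair k w) j                  ≡⟨ lookup-removePair k w j ⟩
  lowerAround k (lookup w (punchIn k j))     ≡⟨ cong (lowerAround k) (inv _ _ (lowerAround≡just k _ j (trans (sym (lookup-removePair k w i)) eq))) ⟩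
  lowerAround k (raiseAround k (just i))     ≡⟨ lowerAround-raiseAround k (just i) ⟩
  just i                                     ∎
  where open ≡-Reasoning

removePair-insertPair : ∀ {m} (k : Fin (suc m)) u → removePair k (tail (insertPair k u)) ≡ u
removePair-insertPair k u =
  trans (cong (map (lowerAround k)) (removeAt-insertAt (map (raiseAround k) u) k (just zero)))
        (map-lowerAround-raiseAround k u)

insertPair-removePair : ∀ {m} (k : Fin (suc m)) w → IsInvolutive (just (suc k) ∷ w) → insertPair k (removePair k w) ≡ just (suc k) ∷ w
insertPair-removePair k w inv =
  cong (just (suc k) ∷_) (trans (cong₂ (λ r z → insertAt r k z) raised (sym wk≡0)) (insertAt-removeAt w k))
  where
  wk≡0 : lookup w k ≡ just zero
  wk≡0 = inv zero (suc k) refl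
  wi≢0 : ∀ i → lookup w (punchIn k i) ≢ just zero
  wi≢0 i eq = punchInᵢ≢i k i (sym (suc-injective (just-injective (inv (suc (punchIn k i)) zero eq))))
  wi≢1+k : ∀ i → lookup w (punchIn k i) ≢ just (suc k)
  wi≢1+k i eq with trans (sym wk≡0) (inv (suc (punchIn k i)) (suc k) eq)
  ... | ()
  raised : map (raiseAround k) (removePair k w) ≡ removeAt w k
  raised = Vec-≡ λ i → begin
    lookup (map (raiseAround k) (removePair k w)) i  ≡⟨ lookup-map i (raiseAround k) (removePair k w) ⟩
    raiseAround k (lookup (removePair k w) i)       ≡⟨ cong (raiseAround k) (lookup-removePair k w i) ⟩
    raiseAround k (lowerAround k (lookup w (punchIn k i))) ≡⟨ raiseAround-lowerAround k _ (wi≢0 i) (wi≢1+k i) ⟩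
    lookup w (punchIn k i)                          ≡⟨ lookup-removeAt w k i ⟨
    lookup (removeAt w k) i                         ∎
    where open ≡-Reasoning

numPartialInvolutions : ℕ → ℕ
numPartialInvolutions zero          = 1
numPartialInvolutions (suc zero)    = 2
numPartialInvolutions (suc (suc n)) =
  numPartialInvolutions (suc n) + (numPartialInvolutions (suc n) + suc n * numPartialInvolutions n)

MatchedHead : ℕ → Set
MatchedHead zero    = ⊥
MatchedHead (suc m) = Fin (suc m) × PartialInvolution m

PartialInvolutionSplit : ℕ → Set
PartialInvolutionSplit m = PartialInvolution m ⊎ (PartialInvolution m ⊎ MatchedHead m)

splitHead : ∀ {m} x (w : Vec (Maybe (Fin (suc m))) m) → IsInvolutive (x ∷ w) → PartialInvolutionSplit m
splitHead nothing w inv =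
  inj₁ (map lower w , IsInvolutive⇒isInvolutive (map lower w) (IsInvolutive-lower _ w inv))
splitHead (just zero) w inv =
  inj₂ (inj₁ (map lower w , IsInvolutive⇒isInvolutive (map lower w) (IsInvolutive-lower _ w inv)))
splitHead {suc m} (just (suc k)) w inv =
  inj₂ (inj₂ (k , removePair k w , IsInvolutive⇒isInvolutive (removePair k w) (IsInvolutive-removePair k w inv)))

split : ∀ {m} → PartialInvolution (suc m) → PartialInvolutionSplit m
split (x ∷ w , t) = splitHead x w (isInvolutive⇒IsInvolutive (x ∷ w) t)

consFixed : ∀ {m} {x} → Fixed x → PartialInvolution m → PartialInvolution (suc m)
consFixed {x = x} fixed (u , t) =
  x ∷ map raise u , IsInvolutive⇒isInvolutive (x ∷ map raise u) (IsInvolutive-raise fixed u (isInvolutive⇒IsInvolutive u t))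

unsplit : ∀ {m} → PartialInvolutionSplit m → PartialInvolution (suc m)
unsplit (inj₁ p)                    = consFixed unmatched p
unsplit (inj₂ (inj₁ p))             = consFixed selfMatched p
unsplit {suc m} (inj₂ (inj₂ (k , u , t))) =
  insertPair k u , IsInvolutive⇒isInvolutive (insertPair k u) (IsInvolutive-insertPair k u (isInvolutive⇒IsInvolutive u t))

split-unsplit : ∀ {m} (s : PartialInvolutionSplit m) → split (unsplit s) ≡ s
split-unsplit (inj₁ (u , _))        = cong inj₁ (Σ-T-≡ isInvolutive (map-lower-raise u))
split-unsplit (inj₂ (inj₁ (u , _))) = cong (inj₂ ∘ inj₁) (Σ-T-≡ isInvolutive (map-lower-raise u))
split-unsplit {suc m} (inj₂ (inj₂ (k , u , _))) =
  cong (λ v → inj₂ (inj₂ (k , v))) (Σ-T-≡ isInvolutive (removePair-insertPair k u))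

unsplit-split : ∀ {m} (p : PartialInvolution (suc m)) → unsplit (split p) ≡ p
unsplit-split (nothing ∷ w , t) =
  Σ-T-≡ isInvolutive (cong (nothing ∷_) (map-raise-lower unmatched w (isInvolutive⇒IsInvolutive (nothing ∷ w) t)))
unsplit-split (just zero ∷ w , t) =
  Σ-T-≡ isInvolutive (cong (just zero ∷_) (map-raise-lower selfMatched w (isInvolutive⇒IsInvolutive (just zero ∷ w) t)))
unsplit-split {suc m} (just (suc k) ∷ w , t) =
  Σ-T-≡ isInvolutive (insertPair-removePair k w (isInvolutive⇒IsInvolutive (just (suc k) ∷ w) t))

partialInvolution-suc↔ : ∀ m → PartialInvolution (suc m) ↔ PartialInvolutionSplit m
partialInvolution-suc↔ m = mk↔ₛ′ split unsplit split-unsplit unsplit-split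

partialInvolution0↔Fin1 : PartialInvolution 0 ↔ Fin 1
partialInvolution0↔Fin1 = mk↔ₛ′ (λ _ → zero) (λ _ → [] , _) (λ { zero → refl }) (λ { ([] , _) → refl })

partialInvolution↔Fin : ∀ m → PartialInvolution m ↔ Fin (numPartialInvolutions m)
partialInvolution↔Fin zero          = partialInvolution0↔Fin1
partialInvolution↔Fin (suc zero)    =
  ↔-trans (partialInvolution-suc↔ 0)
    (↔-trans (partialInvolution0↔Fin1 ⊎-↔ (partialInvolution0↔Fin1 ⊎-↔ ↔-sym 0↔⊥))
      (↔-sym (↔-trans (+↔⊎ {1} {1}) (↔-refl ⊎-↔ +↔⊎ {1} {0}))))
partialInvolution↔Fin (suc (suc m)) =
  ↔-trans (partialInvolution-suc↔ (suc m))
    (↔-trans (partialInvolution↔Fin (suc m) ⊎-↔ (partialInvolution↔Fin (suc m) ⊎-↔ (↔-refl ×-↔ partialInvolution↔Fin m)))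
      (↔-sym (↔-trans (+↔⊎ {a (suc m)} {a (suc m) + suc m * a m})
        (↔-refl ⊎-↔ (↔-trans (+↔⊎ {a (suc m)} {suc m * a m}) (↔-refl ⊎-↔ *↔× {suc m} {a m}))))))
  where
  a : ℕ → ℕ
  a = numPartialInvolutions

-- Clans with base clan -…-+…+

opposite-↑ˡ : ∀ n (i : Fin n) → opposite (i ↑ˡ n) ≡ n ↑ʳ opposite i
opposite-↑ˡ n i = toℕ-injective (begin
  toℕ (opposite (i ↑ˡ n))        ≡⟨ opposite-prop (i ↑ˡ n) ⟩
  n + n ∸ suc (toℕ (i ↑ˡ n))     ≡⟨ cong (λ t → n + n ∸ suc t) (toℕ-↑ˡ i n) ⟩
  n + n ∸ suc (toℕ i)            ≡⟨ +-∸-assoc n (toℕ<n i) ⟩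
  n + (n ∸ suc (toℕ i))          ≡⟨ cong (n +_) (opposite-prop i) ⟨
  n + toℕ (opposite i)           ≡⟨ toℕ-↑ʳ n (opposite i) ⟨
  toℕ (n ↑ʳ opposite i)          ∎)
  where open ≡-Reasoning

opposite-↑ʳ : ∀ n (r : Fin n) → opposite (n ↑ʳ r) ≡ opposite r ↑ˡ n
opposite-↑ʳ n r = begin
  opposite (n ↑ʳ r)                        ≡⟨ cong (λ t → opposite (n ↑ʳ t)) (opposite-involutive r) ⟨
  opposite (n ↑ʳ opposite (opposite r))    ≡⟨ cong opposite (opposite-↑ˡ n (opposite r)) ⟨
  opposite (opposite (opposite r ↑ˡ n))    ≡⟨ opposite-involutive _ ⟩
  opposite r ↑ˡ n                          ∎
  where open ≡-Reasoning

data Half (n : ℕ) : Fin (n + n) → Set where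
  left  : (i : Fin n) → Half n (i ↑ˡ n)
  right : (r : Fin n) → Half n (n ↑ʳ r)

half : ∀ n p → Half n p
half n p = subst (Half n) (join-splitAt n n p) (fromSplit (splitAt n p))
  where
  fromSplit : (s : Fin n ⊎ Fin n) → Half n (join n n s)
  fromSplit (inj₁ i) = left i
  fromSplit (inj₂ r) = right r

toℕ-↑ˡ<↑ʳ : ∀ n (i r : Fin n) → toℕ (i ↑ˡ n) < toℕ (n ↑ʳ r)
toℕ-↑ˡ<↑ʳ n i r rewrite toℕ-↑ˡ i n | toℕ-↑ʳ n r = <-≤-trans (toℕ<n i) (m≤m+n n (toℕ r))

↑ˡ≢↑ʳ : ∀ n (i r : Fin n) → i ↑ˡ n ≢ n ↑ʳ r
↑ˡ≢↑ʳ n i r eq = <-irrefl (cong toℕ eq) (toℕ-↑ˡ<↑ʳ n i r)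

lookup-∷ʳ-last : ∀ {A : Set} {k} (xs : Vec A k) x → lookup (xs ∷ʳ x) (fromℕ k) ≡ x
lookup-∷ʳ-last []       x = refl
lookup-∷ʳ-last (y ∷ xs) x = lookup-∷ʳ-last xs x

lookup-∷ʳ-inject₁ : ∀ {A : Set} {k} (xs : Vec A k) x i → lookup (xs ∷ʳ x) (inject₁ i) ≡ lookup xs i
lookup-∷ʳ-inject₁ (y ∷ xs) x zero    = refl
lookup-∷ʳ-inject₁ (y ∷ xs) x (suc i) = lookup-∷ʳ-inject₁ xs x i

lookup-reverse-opposite : ∀ {A : Set} {k} (xs : Vec A k) i → lookup (reverse xs) (opposite i) ≡ lookup xs i
lookup-reverse-opposite (x ∷ xs) i rewrite reverse-∷ x xs with i
... | zero  = lookup-∷ʳ-last (reverse xs) x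
... | suc i = trans (lookup-∷ʳ-inject₁ (reverse xs) x (opposite i)) (lookup-reverse-opposite xs i)

lookup-reverse : ∀ {A : Set} {k} (xs : Vec A k) r → lookup (reverse xs) r ≡ lookup xs (opposite r)
lookup-reverse xs r = trans (cong (lookup (reverse xs)) (sym (opposite-involutive r))) (lookup-reverse-opposite xs (opposite r))

countSym-++ : ∀ {m k l} (s : Sym m) (xs : Vec (Sym m) k) (ys : Vec (Sym m) l) →
  countSym s (xs ++ ys) ≡ countSym s xs + countSym s ys
countSym-++ s []       ys = refl
countSym-++ s (x ∷ xs) ys = trans (cong (when (s == x) 1 +_) (countSym-++ s xs ys)) (sym (+-assoc (when (s == x) 1) _ _))

countSym-∷ʳ : ∀ {m k} (s : Sym m) (xs : Vec (Sym m) k) x → countSym s (xs ∷ʳ x) ≡ countSym s xs + when (s == x) 1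
countSym-∷ʳ s []       x = +-comm (when (s == x) 1) 0
countSym-∷ʳ s (y ∷ xs) x = trans (cong (when (s == y) 1 +_) (countSym-∷ʳ s xs x)) (sym (+-assoc (when (s == y) 1) _ _))

countSym-reverse : ∀ {m k} (s : Sym m) (xs : Vec (Sym m) k) → countSym s (reverse xs) ≡ countSym s xs
countSym-reverse s []       = refl
countSym-reverse s (x ∷ xs) = begin
  countSym s (reverse (x ∷ xs))              ≡⟨ cong (countSym s) (reverse-∷ x xs) ⟩
  countSym s (reverse xs ∷ʳ x)               ≡⟨ countSym-∷ʳ s (reverse xs) x ⟩
  countSym s (reverse xs) + when (s == x) 1 ≡⟨ cong (_+ when (s == x) 1) (countSym-reverse s xs) ⟩
  countSym s xs + when (s == x) 1         ≡⟨ +-comm (countSym s xs) _ ⟩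
  countSym s (x ∷ xs)                        ∎
  where open ≡-Reasoning

==-refl : ∀ {m} (s : Sym m) → T (s == s)
==-refl plus     = _
==-refl minus    = _
==-refl (pair i) = fromWitness {a? = i ≟ i} refl

==⇒≡ : ∀ {m} (s t : Sym m) → T (s == t) → s ≡ t
==⇒≡ plus     plus     _ = refl
==⇒≡ minus    minus    _ = refl
==⇒≡ (pair i) (pair j) t = cong pair (toWitness t)

≡⇒== : ∀ {m} {s t : Sym m} → s ≡ t → T (s == t)
≡⇒== {s = s} refl = ==-refl s

isClan⇒paired : ∀ {m} (c : Vec (Sym m) m) → T (isClan c) → ∀ p j → lookup c p ≡ pair j → lookup c j ≡ pair p
isClan⇒paired c t p j cp≡ with all-allFin⁺ _ (proj₁ (Equivalence.to T-∧ t)) p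
... | okp with lookup c p
isClan⇒paired c t p j refl | okp | .(pair j) = ==⇒≡ _ _ (proj₂ (Equivalence.to T-∧ okp))

all≡false : ∀ {A : Set} {q : A → Bool} xs → all q xs ≡ false → Σ A (λ x → q x ≡ false)
all≡false {q = q} (x List.∷ xs) eq with q x in qx
... | false = x , qx
... | true  = all≡false xs eq

∧≡false : ∀ {a b : Bool} → a ∧ b ≡ false → T b → a ≡ false
∧≡false {false}        _  _ = refl
∧≡false {true} {true}  () _

T≢false : ∀ {b : Bool} → T b → b ≢ false
T≢false {true} _ ()

-- isClan tests each position by a local case analysis on its symbol, which cannot be named here,
-- so we refute a failing position instead.
paired⇒isClan : ∀ {m} (c : Vec (Sym m) m) → (∀ p j → lookup c p ≡ pair j → p ≢ j × lookup c j ≡ pair p) →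
  countSym plus c ≡ countSym minus c → T (isClan c)
paired⇒isClan {m} c paired balanced with isClan c in isClan≡
... | true  = _
... | false with all≡false (allFin m) (∧≡false isClan≡ (≡⇒≡ᵇ _ _ balanced))
...   | p , okp≡false with lookup c p | paired p
...     | plus   | _ = T≢false _ okp≡false
...     | minus  | _ = T≢false _ okp≡false
...     | pair j | pairedp =
  T≢false (Equivalence.from T-∧ (fromWitnessFalse (proj₁ (pairedp j refl)) , ≡⇒== (proj₂ (pairedp j refl)))) okp≡false

module _ (n : ℕ) where

  -- Left position i carries - when σ i is undefined, and otherwise is paired with the mirror
  -- image of position σ i; the right half is then forced by skew-symmetry.
  leftSym : Maybe (Fin n) → Sym (n + n)
  leftSym nothing  = minus
  leftSym (just j) = pair (n ↑ʳ opposite j)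

  rightSym : Maybe (Fin n) → Sym (n + n)
  rightSym nothing  = plus
  rightSym (just j) = pair (j ↑ˡ n)

  toClan : PartialMap n → Vec (Sym (n + n)) (n + n)
  toClan v = map leftSym v ++ reverse (map rightSym v)

  mirrorLeft : Fin (n + n) → Fin n
  mirrorLeft p with splitAt n p
  ... | inj₁ i = i
  ... | inj₂ r = opposite r

  partnerOf : Sym (n + n) → Maybe (Fin n)
  partnerOf plus     = nothing
  partnerOf minus    = nothing
  partnerOf (pair q) = just (mirrorLeft q)

  fromClan : Vec (Sym (n + n)) (n + n) → PartialMap n
  fromClan c = tabulate (λ i → partnerOf (lookup c (i ↑ˡ n)))

  mirrorLeft-↑ʳ : ∀ r → mirrorLeft (n ↑ʳ r) ≡ opposite r
  mirrorLeft-↑ʳ r rewrite splitAt-↑ʳ n n r = refl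

  lookup-toClan-↑ˡ : ∀ v i → lookup (toClan v) (i ↑ˡ n) ≡ leftSym (lookup v i)
  lookup-toClan-↑ˡ v i = trans (lookup-++ˡ (map leftSym v) (reverse (map rightSym v)) i) (lookup-map i leftSym v)

  lookup-toClan-↑ʳ : ∀ v r → lookup (toClan v) (n ↑ʳ r) ≡ rightSym (lookup v (opposite r))
  lookup-toClan-↑ʳ v r = trans (lookup-++ʳ (map leftSym v) (reverse (map rightSym v)) r)
    (trans (lookup-reverse (map rightSym v) r) (lookup-map (opposite r) rightSym v))

  lookup-fromClan : ∀ c i → lookup (fromClan c) i ≡ partnerOf (lookup c (i ↑ˡ n))
  lookup-fromClan c i = lookup∘tabulate _ i

  countSym-plus-leftSym : ∀ {k} (v : Vec (Maybe (Fin n)) k) → countSym plus (map leftSym v) ≡ 0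
  countSym-plus-leftSym []            = refl
  countSym-plus-leftSym (nothing ∷ v) = countSym-plus-leftSym v
  countSym-plus-leftSym (just _ ∷ v)  = countSym-plus-leftSym v

  countSym-minus-rightSym : ∀ {k} (v : Vec (Maybe (Fin n)) k) → countSym minus (map rightSym v) ≡ 0
  countSym-minus-rightSym []            = refl
  countSym-minus-rightSym (nothing ∷ v) = countSym-minus-rightSym v
  countSym-minus-rightSym (just _ ∷ v)  = countSym-minus-rightSym v

  countSym-plus-rightSym : ∀ {k} (v : Vec (Maybe (Fin n)) k) → countSym plus (map rightSym v) ≡ countSym minus (map leftSym v)
  countSym-plus-rightSym []            = refl
  countSym-plus-rightSym (nothing ∷ v) = cong suc (countSym-plus-rightSym v)
  countSym-plus-rightSym (just _ ∷ v)  = countSym-plus-rightSym v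

  toClan-balanced : ∀ v → countSym plus (toClan v) ≡ countSym minus (toClan v)
  toClan-balanced v = begin
    countSym plus (toClan v)
      ≡⟨ countSym-++ plus (map leftSym v) _ ⟩
    countSym plus (map leftSym v) + countSym plus (reverse (map rightSym v))
      ≡⟨ cong₂ _+_ (countSym-plus-leftSym v) (countSym-reverse plus (map rightSym v)) ⟩
    countSym plus (map rightSym v)
      ≡⟨ countSym-plus-rightSym v ⟩
    countSym minus (map leftSym v)
      ≡⟨ +-identityʳ _ ⟨
    countSym minus (map leftSym v) + 0
      ≡⟨ cong (countSym minus (map leftSym v) +_) (trans (countSym-reverse minus (map rightSym v)) (countSym-minus-rightSym v)) ⟨
    countSym minus (map leftSym v) + countSym minus (reverse (map rightSym v))
      ≡⟨ countSym-++ minus (map leftSym v) _ ⟨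
    countSym minus (toClan v) ∎
    where open ≡-Reasoning

toClan-paired : ∀ n (v : PartialMap n) → IsInvolutive v →
  ∀ p q → lookup (toClan n v) p ≡ pair q → p ≢ q × lookup (toClan n v) q ≡ pair p
toClan-paired n v inv p q eq with half n p
... | left i with lookup v i in vi≡ | trans (sym (lookup-toClan-↑ˡ n v i)) eq
...   | just j | refl = ↑ˡ≢↑ʳ n i (opposite j) , (begin
  lookup (toClan n v) (n ↑ʳ opposite j)  ≡⟨ lookup-toClan-↑ʳ n v (opposite j) ⟩
  rightSym n (lookup v (opposite (opposite j))) ≡⟨ cong (rightSym n ∘ lookup v) (opposite-involutive j) ⟩
  rightSym n (lookup v j)                ≡⟨ cong (rightSym n) (inv i j vi≡) ⟩
  pair (i ↑ˡ n)                          ∎)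
  where open ≡-Reasoning
toClan-paired n v inv p q eq | right r with lookup v (opposite r) in vr≡ | trans (sym (lookup-toClan-↑ʳ n v r)) eq
...   | just j | refl = (λ eq′ → ↑ˡ≢↑ʳ n j r (sym eq′)) , (begin
  lookup (toClan n v) (j ↑ˡ n)           ≡⟨ lookup-toClan-↑ˡ n v j ⟩
  leftSym n (lookup v j)                 ≡⟨ cong (leftSym n) (inv (opposite r) j vr≡) ⟩
  pair (n ↑ʳ opposite (opposite r))      ≡⟨ cong (λ t → pair (n ↑ʳ t)) (opposite-involutive r) ⟩
  pair (n ↑ʳ r)                          ∎)
  where open ≡-Reasoning

toClan-skew : ∀ n (v : PartialMap n) p → lookup (toClan n v) p ≡ negRev (lookup (toClan n v) (opposite p))
toClan-skew n v p with half n p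
... | left i = begin
  lookup (toClan n v) (i ↑ˡ n)                    ≡⟨ lookup-toClan-↑ˡ n v i ⟩
  leftSym n (lookup v i)                          ≡⟨ leftSym≡negRev-rightSym (lookup v i) ⟩
  negRev (rightSym n (lookup v i))                ≡⟨ cong (negRev ∘ rightSym n ∘ lookup v) (opposite-involutive i) ⟨
  negRev (rightSym n (lookup v (opposite (opposite i)))) ≡⟨ cong negRev (lookup-toClan-↑ʳ n v (opposite i)) ⟨
  negRev (lookup (toClan n v) (n ↑ʳ opposite i))  ≡⟨ cong (negRev ∘ lookup (toClan n v)) (opposite-↑ˡ n i) ⟨
  negRev (lookup (toClan n v) (opposite (i ↑ˡ n))) ∎
  where
  open ≡-Reasoning
  leftSym≡negRev-rightSym : ∀ x → leftSym n x ≡ negRev (rightSym n x)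
  leftSym≡negRev-rightSym nothing  = refl
  leftSym≡negRev-rightSym (just j) = cong pair (sym (opposite-↑ˡ n j))
... | right r = begin
  lookup (toClan n v) (n ↑ʳ r)                    ≡⟨ lookup-toClan-↑ʳ n v r ⟩
  rightSym n (lookup v (opposite r))              ≡⟨ rightSym≡negRev-leftSym (lookup v (opposite r)) ⟩
  negRev (leftSym n (lookup v (opposite r)))      ≡⟨ cong negRev (lookup-toClan-↑ˡ n v (opposite r)) ⟨
  negRev (lookup (toClan n v) (opposite r ↑ˡ n))  ≡⟨ cong (negRev ∘ lookup (toClan n v)) (opposite-↑ʳ n r) ⟨
  negRev (lookup (toClan n v) (opposite (n ↑ʳ r))) ∎
  where
  open ≡-Reasoning
  rightSym≡negRev-leftSym : ∀ x → rightSym n x ≡ negRev (leftSym n x)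
  rightSym≡negRev-leftSym nothing  = refl
  rightSym≡negRev-leftSym (just j) =
    cong pair (sym (trans (opposite-↑ʳ n (opposite j)) (cong (_↑ˡ n) (opposite-involutive j))))

if-T : ∀ {A : Set} {b} {x y : A} → T b → (if b then x else y) ≡ x
if-T {b = true} _ = refl

if-¬T : ∀ {A : Set} {b} {x y : A} → ¬ T b → (if b then x else y) ≡ y
if-¬T {b = false} _  = refl
if-¬T {b = true}  ¬t = ⊥-elim (¬t _)

if≡minus⇒T : ∀ {m} b → _≡_ {A = Sym m} (if b then minus else plus) minus → T b
if≡minus⇒T true _ = _

baseSymOf : ∀ {m} → Fin m → Sym m → Sym m
baseSymOf p plus     = plus
baseSymOf p minus    = minus
baseSymOf p (pair q) = if toℕ p <ᵇ toℕ q then minus else plus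

baseSym≡baseSymOf : ∀ {m} (c : Vec (Sym m) m) p {s} → lookup c p ≡ s → baseSym c p ≡ baseSymOf p s
baseSym≡baseSymOf c p eq with lookup c p
baseSym≡baseSymOf c p refl | plus   = refl
baseSym≡baseSymOf c p refl | minus  = refl
baseSym≡baseSymOf c p refl | pair q = refl

standardBase-↑ˡ : ∀ n (i : Fin n) → standardBase n (i ↑ˡ n) ≡ minus
standardBase-↑ˡ n i = if-T (<⇒<ᵇ (subst (_< n) (sym (toℕ-↑ˡ i n)) (toℕ<n i)))

standardBase-↑ʳ : ∀ n (r : Fin n) → standardBase n (n ↑ʳ r) ≡ plus
standardBase-↑ʳ n r = if-¬T (λ t → <⇒≱ (<ᵇ⇒< _ _ t) (subst (n ≤_) (sym (toℕ-↑ʳ n r)) (m≤m+n n (toℕ r))))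

toClan-base : ∀ n (v : PartialMap n) p → baseSym (toClan n v) p ≡ standardBase n p
toClan-base n v p with half n p
... | left i = trans (baseSym≡baseSymOf (toClan n v) (i ↑ˡ n) (lookup-toClan-↑ˡ n v i)) (left-base (lookup v i))
  where
  left-base : ∀ x → baseSymOf (i ↑ˡ n) (leftSym n x) ≡ standardBase n (i ↑ˡ n)
  left-base nothing  = sym (standardBase-↑ˡ n i)
  left-base (just j) = trans (if-T (<⇒<ᵇ (toℕ-↑ˡ<↑ʳ n i (opposite j)))) (sym (standardBase-↑ˡ n i))
... | right r = trans (baseSym≡baseSymOf (toClan n v) (n ↑ʳ r) (lookup-toClan-↑ʳ n v r)) (right-base (lookup v (opposite r)))
  where
  right-base : ∀ x → baseSymOf (n ↑ʳ r) (rightSym n x) ≡ standardBase n (n ↑ʳ r)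
  right-base nothing  = sym (standardBase-↑ʳ n r)
  right-base (just j) = trans (if-¬T (λ t → <-asym (<ᵇ⇒< _ _ t) (toℕ-↑ˡ<↑ʳ n j r))) (sym (standardBase-↑ʳ n r))

isSkewClan : ∀ n → Vec (Sym (n + n)) (n + n) → Bool
isSkewClan n c = isClan c ∧ isSkewSymmetric c ∧ hasStandardBase n c

toClan-isSkewClan : ∀ n (v : PartialMap n) → IsInvolutive v → T (isSkewClan n (toClan n v))
toClan-isSkewClan n v inv = Equivalence.from T-∧
  ( paired⇒isClan (toClan n v) (toClan-paired n v inv) (toClan-balanced n v)
  , Equivalence.from T-∧
      ( all-allFin⁻ _ (λ p → ≡⇒== (toClan-skew n v p))
      , all-allFin⁻ _ (λ p → ≡⇒== (toClan-base n v p))))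

data LeftSym (n : ℕ) : Sym (n + n) → Set where
  unpaired    : LeftSym n minus
  pairedRight : ∀ r → LeftSym n (pair (n ↑ʳ r))

module _ {n : ℕ} {c : Vec (Sym (n + n)) (n + n)} (valid : T (isSkewClan n c)) where

  private
    isClan-c : T (isClan c)
    isClan-c = proj₁ (Equivalence.to (T-∧ {isClan c}) valid)

    skewAndBase : T (isSkewSymmetric c) × T (hasStandardBase n c)
    skewAndBase = Equivalence.to (T-∧ {isSkewSymmetric c}) (proj₂ (Equivalence.to (T-∧ {isClan c}) valid))

  skew-at : ∀ p → lookup c p ≡ negRev (lookup c (opposite p))
  skew-at p = ==⇒≡ _ _ (all-allFin⁺ _ (proj₁ skewAndBase) p)

  base-at : ∀ p → baseSym c p ≡ standardBase n p
  base-at p = ==⇒≡ _ _ (all-allFin⁺ _ (proj₂ skewAndBase) p)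

  leftBase : ∀ i {s} → lookup c (i ↑ˡ n) ≡ s → baseSymOf (i ↑ˡ n) s ≡ minus
  leftBase i eq = trans (sym (baseSym≡baseSymOf c _ eq)) (trans (base-at _) (standardBase-↑ˡ n i))

  leftSym-at : ∀ i → LeftSym n (lookup c (i ↑ˡ n))
  leftSym-at i with lookup c (i ↑ˡ n) in ci≡
  ... | plus with leftBase i ci≡
  ...   | ()
  leftSym-at i | minus  = unpaired
  leftSym-at i | pair q with half n q
  ...   | right r = pairedRight r
  -- a pair within the left half would have - at both of its positions in the base clan
  ...   | left j  = ⊥-elim (<-asym (<ᵇ⇒< (toℕ (i ↑ˡ n)) (toℕ (j ↑ˡ n)) (if≡minus⇒T _ (leftBase i ci≡)))
                                   (<ᵇ⇒< (toℕ (j ↑ˡ n)) (toℕ (i ↑ˡ n)) (if≡minus⇒T _ (leftBase j (isClan⇒paired c isClan-c _ _ ci≡)))))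

  fromClan-involutive : IsInvolutive (fromClan n c)
  fromClan-involutive i j eq with lookup c (i ↑ˡ n) in ci≡ | leftSym-at i | trans (sym (lookup-fromClan n c i)) eq
  ... | .(pair (n ↑ʳ r)) | pairedRight r | ci≡j rewrite sym (trans (sym (mirrorLeft-↑ʳ n r)) (just-injective ci≡j)) = begin
    lookup (fromClan n c) (opposite r)                         ≡⟨ lookup-fromClan n c (opposite r) ⟩
    partnerOf n (lookup c (opposite r ↑ˡ n))                   ≡⟨ cong (partnerOf n ∘ lookup c) (opposite-↑ʳ n r) ⟨
    partnerOf n (lookup c (opposite (n ↑ʳ r)))                 ≡⟨ cong (partnerOf n) (skew-at (opposite (n ↑ʳ r))) ⟩
    partnerOf n (negRev (lookup c (opposite (opposite (n ↑ʳ r))))) ≡⟨ cong (partnerOf n ∘ negRev ∘ lookup c) (opposite-involutive (n ↑ʳ r)) ⟩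
    partnerOf n (negRev (lookup c (n ↑ʳ r)))                   ≡⟨ cong (partnerOf n ∘ negRev) (isClan⇒paired c isClan-c _ _ ci≡) ⟩
    just (mirrorLeft n (opposite (i ↑ˡ n)))                    ≡⟨ cong (just ∘ mirrorLeft n) (opposite-↑ˡ n i) ⟩
    just (mirrorLeft n (n ↑ʳ opposite i))                      ≡⟨ cong just (trans (mirrorLeft-↑ʳ n (opposite i)) (opposite-involutive i)) ⟩
    just i                                                     ∎
    where open ≡-Reasoning

  leftSym-partnerOf : ∀ {s} → LeftSym n s → leftSym n (partnerOf n s) ≡ s
  leftSym-partnerOf unpaired        = refl
  leftSym-partnerOf (pairedRight r) =
    cong (λ t → pair (n ↑ʳ t)) (trans (cong opposite (mirrorLeft-↑ʳ n r)) (opposite-involutive r))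

  rightSym-partnerOf : ∀ {s} → LeftSym n s → rightSym n (partnerOf n s) ≡ negRev s
  rightSym-partnerOf unpaired        = refl
  rightSym-partnerOf (pairedRight r) = cong pair (trans (cong (_↑ˡ n) (mirrorLeft-↑ʳ n r)) (sym (opposite-↑ʳ n r)))

  toClan-fromClan : toClan n (fromClan n c) ≡ c
  toClan-fromClan = Vec-≡ lookup-toClan-fromClan
    where
    lookup-toClan-fromClan : ∀ p → lookup (toClan n (fromClan n c)) p ≡ lookup c p
    lookup-toClan-fromClan p with half n p
    ... | left i = begin
      lookup (toClan n (fromClan n c)) (i ↑ˡ n)   ≡⟨ lookup-toClan-↑ˡ n (fromClan n c) i ⟩
      leftSym n (lookup (fromClan n c) i)         ≡⟨ cong (leftSym n) (lookup-fromClan n c i) ⟩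
      leftSym n (partnerOf n (lookup c (i ↑ˡ n))) ≡⟨ leftSym-partnerOf (leftSym-at i) ⟩
      lookup c (i ↑ˡ n)                           ∎
      where open ≡-Reasoning
    ... | right r = begin
      lookup (toClan n (fromClan n c)) (n ↑ʳ r)             ≡⟨ lookup-toClan-↑ʳ n (fromClan n c) r ⟩
      rightSym n (lookup (fromClan n c) (opposite r))       ≡⟨ cong (rightSym n) (lookup-fromClan n c (opposite r)) ⟩
      rightSym n (partnerOf n (lookup c (opposite r ↑ˡ n))) ≡⟨ rightSym-partnerOf (leftSym-at (opposite r)) ⟩
      negRev (lookup c (opposite r ↑ˡ n))                   ≡⟨ cong (negRev ∘ lookup c) (opposite-↑ʳ n r) ⟨
      negRev (lookup c (opposite (n ↑ʳ r)))                 ≡⟨ skew-at (n ↑ʳ r) ⟨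
      lookup c (n ↑ʳ r)                                     ∎
      where open ≡-Reasoning

fromClan-toClan : ∀ n (v : PartialMap n) → fromClan n (toClan n v) ≡ v
fromClan-toClan n v = Vec-≡ λ i →
  trans (lookup-fromClan n (toClan n v) i) (trans (cong (partnerOf n) (lookup-toClan-↑ˡ n v i)) (partnerOf-leftSym (lookup v i)))
  where
  partnerOf-leftSym : ∀ x → partnerOf n (leftSym n x) ≡ x
  partnerOf-leftSym nothing  = refl
  partnerOf-leftSym (just j) = cong just (trans (mirrorLeft-↑ʳ n (opposite j)) (opposite-involutive j))

skewClan↔partialInvolution : ∀ n → SkewClan n ↔ PartialInvolution n
skewClan↔partialInvolution n = mk↔ₛ′ to from to-from from-to
  where
  to : SkewClan n → PartialInvolution n
  to (c , valid) = fromClan n c , IsInvolutive⇒isInvolutive (fromClan n c) (fromClan-involutive {n} {c} valid)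
  from : PartialInvolution n → SkewClan n
  from (v , t) = toClan n v , toClan-isSkewClan n v (isInvolutive⇒IsInvolutive v t)
  to-from : ∀ p → to (from p) ≡ p
  to-from (v , _) = Σ-T-≡ isInvolutive (fromClan-toClan n v)
  from-to : ∀ c → from (to c) ≡ c
  from-to (c , valid) = Σ-T-≡ (isSkewClan n) (toClan-fromClan {n} {c} valid)

-- Evaluating the closed formulas

∑ : ℕ → (ℕ → ℕ) → ℕ
∑ zero    f = 0
∑ (suc n) f = f 0 + ∑ n (f ∘ suc)

syntax ∑ n (λ i → e) = ∑[ i < n ] e

∑-cong : ∀ n {f g} → (∀ i → i < n → f i ≡ g i) → ∑ n f ≡ ∑ n g
∑-cong zero    eq = refl
∑-cong (suc n) eq = cong₂ _+_ (eq 0 (s≤s z≤n)) (∑-cong n (λ i i<n → eq (suc i) (s≤s i<n)))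

∑-zero : ∀ n → ∑[ _ < n ] 0 ≡ 0
∑-zero zero    = refl
∑-zero (suc n) = ∑-zero n

∑-vanish : ∀ n {f} → (∀ i → i < n → f i ≡ 0) → ∑ n f ≡ 0
∑-vanish n eq = trans (∑-cong n eq) (∑-zero n)

∑-distrib-+ : ∀ n f g → ∑[ i < n ] (f i + g i) ≡ ∑ n f + ∑ n g
∑-distrib-+ zero    f g = refl
∑-distrib-+ (suc n) f g =
  trans (cong (f 0 + g 0 +_) (∑-distrib-+ n (f ∘ suc) (g ∘ suc)))
    (solve 4 (λ a b c d → a :+ b :+ (c :+ d) := a :+ c :+ (b :+ d)) refl
      (f 0) (g 0) (∑ n (f ∘ suc)) (∑ n (g ∘ suc)))

∑-distribˡ-* : ∀ n c f → ∑[ i < n ] (c * f i) ≡ c * ∑ n f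
∑-distribˡ-* zero    c f = sym (*-zeroʳ c)
∑-distribˡ-* (suc n) c f =
  trans (cong (c * f 0 +_) (∑-distribˡ-* n c (f ∘ suc))) (sym (*-distribˡ-+ c (f 0) _))

∑-comm : ∀ m n (f : ℕ → ℕ → ℕ) → ∑[ i < m ] ∑[ j < n ] f i j ≡ ∑[ j < n ] ∑[ i < m ] f i j
∑-comm zero    n f = sym (∑-zero n)
∑-comm (suc m) n f = trans (cong (∑ n (f 0) +_) (∑-comm m n (f ∘ suc)))
  (sym (∑-distrib-+ n (f 0) (λ j → ∑[ i < m ] f (suc i) j)))

∑-+ : ∀ n d f → (∀ i → n ≤ i → f i ≡ 0) → ∑ (n + d) f ≡ ∑ n f
∑-+ zero    d f eq = ∑-vanish d (λ i _ → eq i z≤n)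
∑-+ (suc n) d f eq = cong (f 0 +_) (∑-+ n d (f ∘ suc) (λ i n≤i → eq (suc i) (s≤s n≤i)))

∑-extend : ∀ {n N} f → n ≤ N → (∀ i → n ≤ i → f i ≡ 0) → ∑ N f ≡ ∑ n f
∑-extend {n} {N} f n≤N eq = trans (cong (λ m → ∑ m f) (sym (m+[n∸m]≡n n≤N))) (∑-+ n (N ∸ n) f eq)

sum-applyUpTo : ∀ (f g : ℕ → ℕ) n → sum (List.map f (applyUpTo g n)) ≡ ∑ n (f ∘ g)
sum-applyUpTo f g zero    = refl
sum-applyUpTo f g (suc n) = cong (f (g 0) +_) (sum-applyUpTo f (g ∘ suc) n)

choose : ℕ → ℕ → ℕ
choose n       zero    = 1
choose zero    (suc k) = 0
choose (suc n) (suc k) = choose n k + choose n (suc k)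

C≡choose : ∀ n k → n C k ≡ choose n k
C≡choose n       zero    = refl
C≡choose zero    (suc k) = refl
C≡choose (suc n) (suc k) =
  trans (sym (nCk+nC[k+1]≡[n+1]C[k+1] n k)) (cong₂ _+_ (C≡choose n k) (C≡choose n (suc k)))

choose-> : ∀ n k → n < k → choose n k ≡ 0
choose-> zero    (suc k) _         = refl
choose-> (suc n) (suc k) (s≤s n<k) = cong₂ _+_ (choose-> n k n<k) (choose-> n (suc k) (m<n⇒m<1+n n<k))

choose-1 : ∀ n → choose n 1 ≡ n
choose-1 zero    = refl
choose-1 (suc n) = cong suc (choose-1 n)

choose-absorb : ∀ n k → choose n (suc k) * suc k ≡ n * choose (n ∸ 1) k
choose-absorb zero          k       = refl
choose-absorb (suc n)       zero    = trans (*-identityʳ _) (trans (cong suc (choose-1 n)) (sym (*-identityʳ _)))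
choose-absorb (suc zero)    (suc k) = refl
choose-absorb (suc (suc n)) (suc k) = begin
  (x + y) * suc (suc k)            ≡⟨ *-distribʳ-+ (suc (suc k)) x y ⟩
  x * suc (suc k) + y * suc (suc k) ≡⟨ cong₂ _+_ (*-suc x (suc k)) (choose-absorb (suc n) (suc k)) ⟩
  x + x * suc k + suc n * w        ≡⟨ cong (λ t → x + t + suc n * w) (choose-absorb (suc n) k) ⟩
  x + suc n * v + suc n * w        ≡⟨ solve 3 (λ v w m → v :+ w :+ m :* v :+ m :* w := (con 1 :+ m) :* (v :+ w)) refl v w (suc n) ⟩
  suc (suc n) * x                  ∎
  where
  open ≡-Reasoning
  x y v w : ℕ
  x = choose (suc n) (suc k)
  y = choose (suc n) (suc (suc k))
  v = choose n k
  w = choose n (suc k)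

∸-suc : ∀ {n k} → k < n → n ∸ k ≡ suc (n ∸ suc k)
∸-suc {suc n} {zero}  _         = refl
∸-suc {suc n} {suc k} (s≤s k<n) = ∸-suc k<n

choose-suc-* : ∀ n k → choose n (suc k) * (n ∸ k) ≡ choose n (suc k) * suc (n ∸ suc k)
choose-suc-* n k with n ≤? k
... | yes n≤k rewrite choose-> n (suc k) (s≤s n≤k) = refl
... | no  n≰k = cong (choose n (suc k) *_) (∸-suc (≰⇒> n≰k))

choose-shift : ∀ n k → choose n k * (n ∸ k) ≡ choose n (suc k) * suc k
choose-shift zero    k       = trans (cong (choose zero k *_) (0∸n≡0 k)) (*-zeroʳ (choose zero k))
choose-shift (suc n) zero    = trans (+-identityʳ (suc n)) (sym (trans (*-identityʳ _) (cong suc (choose-1 n))))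
choose-shift (suc n) (suc k) = begin
  (x + y) * (n ∸ k)                ≡⟨ *-distribʳ-+ (n ∸ k) x y ⟩
  x * (n ∸ k) + y * (n ∸ k)        ≡⟨ cong₂ _+_ (choose-shift n k) (choose-suc-* n k) ⟩
  y * suc k + y * suc (n ∸ suc k)  ≡⟨ cong (λ t → y * suc k + t) (*-suc y (n ∸ suc k)) ⟩
  y * suc k + (y + y * (n ∸ suc k)) ≡⟨ cong (λ t → y * suc k + (y + t)) (choose-shift n (suc k)) ⟩
  y * suc k + (y + z * suc (suc k)) ≡⟨ solve 3 (λ y z k → y :* (con 1 :+ k) :+ (y :+ z :* (con 2 :+ k)) := (y :+ z) :* (con 2 :+ k)) refl y z k ⟩
  (y + z) * suc (suc k)            ∎
  where
  open ≡-Reasoning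
  x y z : ℕ
  x = choose n k
  y = choose n (suc k)
  z = choose n (suc (suc k))

choose-∸-absorb : ∀ n k → choose n k * (n ∸ k) ≡ n * choose (n ∸ 1) k
choose-∸-absorb n k = trans (choose-shift n k) (choose-absorb n k)

matchings : ℕ → ℕ
matchings zero    = 1
matchings (suc α) = suc (2 * α) * matchings α

2*suc : ∀ α → 2 * suc α ≡ suc (suc (2 * α))
2*suc α = *-suc 2 α

matchings-* : ∀ α → matchings α * (2 ^ α * α !) ≡ (2 * α) !
matchings-* zero    = refl
matchings-* (suc α) = begin
  suc (2 * α) * matchings α * (2 * 2 ^ α * (suc α * α !))
    ≡⟨ solve 4 (λ a m x y → (con 1 :+ con 2 :* a) :* m :* (con 2 :* x :* ((con 1 :+ a) :* y))
                  := (con 2 :+ con 2 :* a) :* ((con 1 :+ con 2 :* a) :* (m :* (x :* y)))) refl α (matchings α) (2 ^ α) (α !) ⟩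
  suc (suc (2 * α)) * (suc (2 * α) * (matchings α * (2 ^ α * α !)))
    ≡⟨ cong (λ t → suc (suc (2 * α)) * (suc (2 * α) * t)) (matchings-* α) ⟩
  suc (suc (2 * α)) !
    ≡⟨ cong _! (2*suc α) ⟨
  (2 * suc α) ! ∎
  where open ≡-Reasoning

partialMatchings : ℕ → ℕ → ℕ
partialMatchings m α = choose m (2 * α) * matchings α

partialMatchings-suc : ∀ m α →
  partialMatchings (suc m) (suc α) ≡ partialMatchings m (suc α) + m * partialMatchings (m ∸ 1) α
partialMatchings-suc m α = begin
  choose (suc m) (2 * suc α) * (s * M)         ≡⟨ cong (λ t → choose (suc m) t * (s * M)) (2*suc α) ⟩
  (x + y) * (s * M)                            ≡⟨ solve 4 (λ x y s m → (x :+ y) :* (s :* m) := y :* (s :* m) :+ x :* s :* m) refl x y s M ⟩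
  y * (s * M) + x * s * M                      ≡⟨ cong (λ t → y * (s * M) + t * M) (choose-absorb m (2 * α)) ⟩
  y * (s * M) + m * choose (m ∸ 1) (2 * α) * M ≡⟨ cong₂ (λ t u → choose m t * (s * M) + u) (sym (2*suc α)) (*-assoc m _ M) ⟩
  partialMatchings m (suc α) + m * partialMatchings (m ∸ 1) α ∎
  where
  open ≡-Reasoning
  s M x y : ℕ
  s = suc (2 * α)
  M = matchings α
  x = choose m s
  y = choose m (suc s)

term : ℕ → ℕ → ℕ → ℕ
term n α β = choose n β * partialMatchings (n ∸ β) α

term-0 : ∀ n α → term n α 0 ≡ partialMatchings n α
term-0 n α = *-identityˡ (partialMatchings n α)

term-vanish : ∀ n α β → n < 2 * α + β → term n α β ≡ 0
term-vanish n α β n<2α+β with n <? β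
... | yes n<β = cong (_* partialMatchings (n ∸ β) α) (choose-> n β n<β)
... | no  n≮β = begin
  choose n β * (choose (n ∸ β) (2 * α) * matchings α) ≡⟨ cong (λ t → choose n β * (t * matchings α)) (choose-> (n ∸ β) (2 * α) n∸β<2α) ⟩
  choose n β * 0                                       ≡⟨ *-zeroʳ (choose n β) ⟩
  0                                                    ∎
  where
  open ≡-Reasoning
  n∸β<2α : n ∸ β < 2 * α
  n∸β<2α = subst (n ∸ β <_) (m+n∸n≡m (2 * α) β) (∸-monoˡ-< n<2α+β (≮⇒≥ n≮β))

term-predβ : ℕ → ℕ → ℕ → ℕ
term-predβ n α zero    = 0
term-predβ n α (suc β) = term n α β

term-predα : ℕ → ℕ → ℕ → ℕ
term-predα n zero    β = 0
term-predα n (suc α) β = n * term (n ∸ 1) α β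

choose-suc-*-partialMatchings : ∀ n α β →
  choose n (suc β) * partialMatchings (n ∸ β) α ≡ term n α (suc β) + term-predα n α (suc β)
choose-suc-*-partialMatchings n α β with n ≤? β
... | yes n≤β rewrite choose-> n (suc β) (s≤s n≤β) = sym (predα≡0 α)
  where
  predα≡0 : ∀ α → term-predα n α (suc β) ≡ 0
  predα≡0 zero    = refl
  predα≡0 (suc α) rewrite choose-> (n ∸ 1) (suc β) (s≤s (≤-trans (m∸n≤m n 1) n≤β)) = *-zeroʳ n
... | no  n≰β rewrite ∸-suc (≰⇒> n≰β) = shift α
  where
  c m : ℕ
  c = choose n (suc β)
  m = n ∸ suc β
  shift : ∀ α → c * partialMatchings (suc m) α ≡ c * partialMatchings m α + term-predα n α (suc β)
  shift zero    = sym (+-identityʳ _)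
  shift (suc α) = begin
    c * partialMatchings (suc m) (suc α)                        ≡⟨ cong (c *_) (partialMatchings-suc m α) ⟩
    c * (partialMatchings m (suc α) + m * partialMatchings (m ∸ 1) α) ≡⟨ solve 4 (λ c p m q → c :* (p :+ m :* q) := c :* p :+ c :* m :* q) refl c _ m _ ⟩
    c * partialMatchings m (suc α) + c * m * partialMatchings (m ∸ 1) α ≡⟨ cong₂ (λ t u → c * partialMatchings m (suc α) + t * partialMatchings u α) (choose-∸-absorb n (suc β)) m∸1≡ ⟩
    c * partialMatchings m (suc α) + n * choose (n ∸ 1) (suc β) * partialMatchings (n ∸ 1 ∸ suc β) α ≡⟨ cong (c * partialMatchings m (suc α) +_) (*-assoc n _ _) ⟩
    c * partialMatchings m (suc α) + term-predα n (suc α) (suc β) ∎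
    where
    open ≡-Reasoning
    m∸1≡ : m ∸ 1 ≡ n ∸ 1 ∸ suc β
    m∸1≡ = trans (∸-+-assoc n (suc β) 1) (trans (cong (n ∸_) (+-comm (suc β) 1)) (sym (∸-+-assoc n 1 (suc β))))

term-suc : ∀ n α β → term (suc n) α β ≡ term n α β + term-predβ n α β + term-predα n α β
term-suc n zero    zero    = refl
term-suc n (suc α) zero    = begin
  term (suc n) (suc α) 0                                      ≡⟨ term-0 (suc n) (suc α) ⟩
  partialMatchings (suc n) (suc α)                            ≡⟨ partialMatchings-suc n α ⟩
  partialMatchings n (suc α) + n * partialMatchings (n ∸ 1) α ≡⟨ cong (_+ n * partialMatchings (n ∸ 1) α) (+-identityʳ (partialMatchings n (suc α))) ⟨
  partialMatchings n (suc α) + 0 + n * partialMatchings (n ∸ 1) α ≡⟨ cong₂ (λ t u → t + 0 + n * u) (term-0 n (suc α)) (term-0 (n ∸ 1) α) ⟨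
  term n (suc α) 0 + 0 + term-predα n (suc α) 0               ∎
  where open ≡-Reasoning
term-suc n α       (suc β) = begin
  (x + y) * P                              ≡⟨ *-distribʳ-+ P x y ⟩
  x * P + y * P                            ≡⟨ cong (x * P +_) (choose-suc-*-partialMatchings n α β) ⟩
  x * P + (term n α (suc β) + term-predα n α (suc β)) ≡⟨ solve 3 (λ a b c → a :+ (b :+ c) := b :+ a :+ c) refl (x * P) (term n α (suc β)) (term-predα n α (suc β)) ⟩
  term n α (suc β) + term n α β + term-predα n α (suc β) ∎
  where
  open ≡-Reasoning
  x y P : ℕ
  x = choose n β
  y = choose n (suc β)
  P = partialMatchings (n ∸ β) α

∑∑-distrib-+ : ∀ A B (f g : ℕ → ℕ → ℕ) →
  ∑[ α < A ] ∑[ β < B ] (f α β + g α β) ≡ ∑[ α < A ] ∑[ β < B ] f α β + ∑[ α < A ] ∑[ β < B ] g α β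
∑∑-distrib-+ A B f g =
  trans (∑-cong A (λ α _ → ∑-distrib-+ B (f α) (g α))) (∑-distrib-+ A (λ α → ∑ B (f α)) (λ α → ∑ B (g α)))

rect : ℕ → ℕ → ℕ → ℕ
rect A B n = ∑[ α < A ] ∑[ β < B ] term n α β

termSum : ℕ → ℕ
termSum n = rect (suc n) (suc n) n

α≤2α+β : ∀ α β → α ≤ 2 * α + β
α≤2α+β α β = ≤-trans (m≤m+n α (α + 0)) (m≤m+n (2 * α) β)

β≤2α+β : ∀ α β → β ≤ 2 * α + β
β≤2α+β α β = m≤n+m β (2 * α)

rect-extend : ∀ {A B} n → suc n ≤ A → suc n ≤ B → rect A B n ≡ termSum n
rect-extend {A} {B} n n<A n<B =
  trans (∑-cong A (λ α _ → ∑-extend (term n α) n<B (λ β n<β → term-vanish n α β (<-≤-trans n<β (β≤2α+β α β)))))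
        (∑-extend (λ α → ∑[ β < suc n ] term n α β) n<A
          (λ α n<α → ∑-vanish (suc n) (λ β _ → term-vanish n α β (<-≤-trans n<α (α≤2α+β α β)))))

termSum-suc : ∀ n → termSum (suc (suc n)) ≡ termSum (suc n) + (termSum (suc n) + suc n * termSum n)
termSum-suc n = begin
  rect A A (suc (suc n))
    ≡⟨ ∑-cong A (λ α _ → ∑-cong A (λ β _ → term-suc (suc n) α β)) ⟩
  ∑[ α < A ] ∑[ β < A ] (term (suc n) α β + term-predβ (suc n) α β + term-predα (suc n) α β)
    ≡⟨ ∑∑-distrib-+ A A (λ α β → term (suc n) α β + term-predβ (suc n) α β) (term-predα (suc n)) ⟩
  ∑[ α < A ] ∑[ β < A ] (term (suc n) α β + term-predβ (suc n) α β) + ∑[ α < A ] ∑[ β < A ] term-predα (suc n) α β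
    ≡⟨ cong (_+ ∑[ α < A ] ∑[ β < A ] term-predα (suc n) α β) (∑∑-distrib-+ A A (term (suc n)) (term-predβ (suc n))) ⟩
  rect A A (suc n) + rect A (suc (suc n)) (suc n) + (∑[ _ < A ] 0 + ∑[ α < suc (suc n) ] ∑[ β < A ] (suc n * term n α β))
    ≡⟨ cong (rect A A (suc n) + rect A (suc (suc n)) (suc n) +_) (cong₂ _+_ (∑-zero A) predα-sum) ⟩
  rect A A (suc n) + rect A (suc (suc n)) (suc n) + suc n * rect (suc (suc n)) A n
    ≡⟨ cong₂ (λ x y → x + y + suc n * rect (suc (suc n)) A n) (rect-extend (suc n) (n≤1+n _) (n≤1+n _)) (rect-extend (suc n) (n≤1+n _) ≤-refl) ⟩
  termSum (suc n) + termSum (suc n) + suc n * rect (suc (suc n)) A n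
    ≡⟨ cong (λ t → termSum (suc n) + termSum (suc n) + suc n * t) (rect-extend n (n≤1+n _) (≤-trans (n≤1+n _) (n≤1+n _))) ⟩
  termSum (suc n) + termSum (suc n) + suc n * termSum n
    ≡⟨ +-assoc (termSum (suc n)) _ _ ⟩
  termSum (suc n) + (termSum (suc n) + suc n * termSum n) ∎
  where
  open ≡-Reasoning
  A : ℕ
  A = suc (suc (suc n))
  predα-sum : ∑[ α < suc (suc n) ] ∑[ β < A ] (suc n * term n α β) ≡ suc n * rect (suc (suc n)) A n
  predα-sum = trans (∑-cong (suc (suc n)) (λ α _ → ∑-distribˡ-* A (suc n) (term n α)))
                    (∑-distribˡ-* (suc (suc n)) (suc n) (λ α → ∑ A (term n α)))

termSum≡numPartialInvolutions : ∀ n → termSum n ≡ numPartialInvolutions n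
termSum≡numPartialInvolutions zero          = refl
termSum≡numPartialInvolutions (suc zero)    = refl
termSum≡numPartialInvolutions (suc (suc n)) = trans (termSum-suc n)
  (cong₂ (λ x y → x + (x + suc n * y)) (termSum≡numPartialInvolutions (suc n)) (termSum≡numPartialInvolutions n))

when-≡ᵇ-cong : ∀ x k {c d} → (x ≡ k → c ≡ d) → when (x ≡ᵇ k) c ≡ when (x ≡ᵇ k) d
when-≡ᵇ-cong x k eq with x ≡ᵇ k in b
... | true  = eq (≡ᵇ⇒≡ x k (Equivalence.from T-≡ b))
... | false = refl

when-≡ᵇ-≢ : ∀ x k c → x ≢ k → when (x ≡ᵇ k) c ≡ 0
when-≡ᵇ-≢ x k c x≢k with x ≡ᵇ k in b
... | true  = ⊥-elim (x≢k (≡ᵇ⇒≡ x k (Equivalence.from T-≡ b)))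
... | false = refl

∑-when-≡ᵇ : ∀ x K c → ∑[ k < K ] when (x ≡ᵇ k) c ≡ when (x <ᵇ K) c
∑-when-≡ᵇ zero    zero    c = refl
∑-when-≡ᵇ (suc x) zero    c = refl
∑-when-≡ᵇ zero    (suc K) c = trans (cong (c +_) (∑-zero K)) (+-identityʳ c)
∑-when-≡ᵇ (suc x) (suc K) c = ∑-when-≡ᵇ x K c

diagonalSum : ℕ → (ℕ → ℕ → ℕ) → ℕ
diagonalSum n f = ∑[ k < suc n ] ∑[ α < suc k ] ∑[ β < suc k ] when (2 * α + β ≡ᵇ k) (f α β)

doubleSum≡diagonalSum : ∀ n f → doubleSum n f ≡ diagonalSum n f
doubleSum≡diagonalSum n f =
  trans (sum-applyUpTo (λ k → sum (List.map (λ α → sum (List.map (λ β → when (2 * α + β ≡ᵇ k) (f α β)) (upTo (suc k)))) (upTo (suc k)))) id (suc n))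
    (∑-cong (suc n) (λ k _ → trans (sum-applyUpTo (λ α → sum (List.map (λ β → when (2 * α + β ≡ᵇ k) (f α β)) (upTo (suc k)))) id (suc k))
      (∑-cong (suc k) (λ α _ → sum-applyUpTo (λ β → when (2 * α + β ≡ᵇ k) (f α β)) id (suc k)))))

doubleSum-cong : ∀ n {f g : ℕ → ℕ → ℕ} → (∀ α β → 2 * α + β ≤ n → f α β ≡ g α β) → doubleSum n f ≡ doubleSum n g
doubleSum-cong n {f} {g} eq = begin
  doubleSum n f   ≡⟨ doubleSum≡diagonalSum n f ⟩
  diagonalSum n f ≡⟨ ∑-cong (suc n) (λ k k<1+n → ∑-cong (suc k) (λ α _ → ∑-cong (suc k) (λ β _ →
                       when-≡ᵇ-cong (2 * α + β) k (λ 2α+β≡k → eq α β (subst (_≤ n) (sym 2α+β≡k) (≤-pred k<1+n)))))) ⟩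
  diagonalSum n g ≡⟨ doubleSum≡diagonalSum n g ⟨
  doubleSum n g   ∎
  where open ≡-Reasoning

doubleSum≡rectangle : ∀ n f → (∀ α β → n < 2 * α + β → f α β ≡ 0) →
  doubleSum n f ≡ ∑[ α < suc n ] ∑[ β < suc n ] f α β
doubleSum≡rectangle n f vanish = begin
  doubleSum n f
    ≡⟨ doubleSum≡diagonalSum n f ⟩
  ∑[ k < N ] ∑[ α < suc k ] ∑[ β < suc k ] h k α β
    ≡⟨ ∑-cong N (λ k k<N → sym (extend k (≤-pred k<N))) ⟩
  ∑[ k < N ] ∑[ α < N ] ∑[ β < N ] h k α β
    ≡⟨ ∑-comm N N (λ k α → ∑[ β < N ] h k α β) ⟩
  ∑[ α < N ] ∑[ k < N ] ∑[ β < N ] h k α β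
    ≡⟨ ∑-cong N (λ α _ → ∑-comm N N (λ k β → h k α β)) ⟩
  ∑[ α < N ] ∑[ β < N ] ∑[ k < N ] h k α β
    ≡⟨ ∑-cong N (λ α _ → ∑-cong N (λ β _ → trans (∑-when-≡ᵇ (2 * α + β) N (f α β)) (inRange α β))) ⟩
  ∑[ α < N ] ∑[ β < N ] f α β ∎
  where
  open ≡-Reasoning
  N : ℕ
  N = suc n
  h : ℕ → ℕ → ℕ → ℕ
  h k α β = when (2 * α + β ≡ᵇ k) (f α β)
  inRange : ∀ α β → when (2 * α + β <ᵇ N) (f α β) ≡ f α β
  inRange α β with 2 * α + β <ᵇ N in b
  ... | true  = refl
  ... | false = sym (vanish α β (≰⇒> (λ 2α+β≤n → subst T b (<⇒<ᵇ (s≤s 2α+β≤n)))))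
  extend : ∀ k → k ≤ n → ∑[ α < N ] ∑[ β < N ] h k α β ≡ ∑[ α < suc k ] ∑[ β < suc k ] h k α β
  extend k k≤n =
    trans (∑-cong N (λ α _ → ∑-extend (h k α) (s≤s k≤n)
            (λ β k<β → when-≡ᵇ-≢ (2 * α + β) k (f α β) (λ 2α+β≡k → <⇒≱ k<β (subst (β ≤_) 2α+β≡k (β≤2α+β α β))))))
          (∑-extend (λ α → ∑[ β < suc k ] h k α β) (s≤s k≤n)
            (λ α k<α → ∑-vanish (suc k) (λ β _ → when-≡ᵇ-≢ (2 * α + β) k (f α β) (λ 2α+β≡k → <⇒≱ k<α (subst (α ≤_) 2α+β≡k (α≤2α+β α β))))))

den₁-nonZero : ∀ α → NonZero (den₁ α)
den₁-nonZero α = m*n≢0 (2 ^ α) (α !) {{m^n≢0 2 α}} {{α !≢0}}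

[2α]!/den₁≡matchings : ∀ α → ((2 * α) ! / den₁ α) {{den₁-nonZero α}} ≡ matchings α
[2α]!/den₁≡matchings α =
  trans (/-congˡ {o = den₁ α} {{den₁-nonZero α}} (sym (matchings-* α))) (m*n/n≡m (matchings α) (den₁ α) {{den₁-nonZero α}})

term₁≡term : ∀ n α β → term₁ n α β ≡ term n α β
term₁≡term n α β = begin
  (n C β) * ((n ∸ β) C (2 * α)) * ((2 * α) ! / den₁ α)     ≡⟨ *-assoc (n C β) ((n ∸ β) C (2 * α)) _ ⟩
  (n C β) * (((n ∸ β) C (2 * α)) * ((2 * α) ! / den₁ α))         ≡⟨ cong (λ z → (n C β) * (((n ∸ β) C (2 * α)) * z)) ([2α]!/den₁≡matchings α) ⟩
  (n C β) * (((n ∸ β) C (2 * α)) * matchings α)                   ≡⟨ cong₂ (λ x y → x * (y * matchings α)) (C≡choose n β) (C≡choose (n ∸ β) (2 * α)) ⟩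
  term n α β                                                  ∎
  where
  open ≡-Reasoning
  instance _ = den₁-nonZero α

den₂-nonZero : ∀ n α β → NonZero (den₂ n α β)
den₂-nonZero n α β = m*n≢0 ((n ∸ β ∸ 2 * α) !) (2 ^ α * α !) {{(n ∸ β ∸ 2 * α) !≢0}} {{den₁-nonZero α}}

[n∸β]!/den₂≡C*matchings : ∀ n α β → 2 * α + β ≤ n →
  ((n ∸ β) ! / den₂ n α β) {{den₂-nonZero n α β}} ≡ ((n ∸ β) C (2 * α)) * matchings α
[n∸β]!/den₂≡C*matchings n α β 2α+β≤n =
  trans (/-congˡ {o = den₂ n α β} N!≡) (m*n/n≡m ((N C k) * matchings α) (den₂ n α β))
  where
  N k : ℕ
  N = n ∸ β
  k = 2 * α
  instance
    _ : NonZero (k ! * (N ∸ k) !)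
    _ = m*n≢0 (k !) ((N ∸ k) !) {{k !≢0}} {{(N ∸ k) !≢0}}
    _ : NonZero (den₂ n α β)
    _ = den₂-nonZero n α β
  k≤N : k ≤ N
  k≤N = m+n≤o⇒m≤o∸n k 2α+β≤n
  N!≡ : N ! ≡ ((N C k) * matchings α) * den₂ n α β
  N!≡ = begin
    N !                                           ≡⟨ m*[n/m]≡n (k![n∸k]!∣n! k≤N) ⟨
    k ! * (N ∸ k) ! * (N ! / (k ! * (N ∸ k) !))   ≡⟨ cong (k ! * (N ∸ k) ! *_) (nCk≡n!/k![n-k]! k≤N) ⟨
    k ! * (N ∸ k) ! * (N C k)                     ≡⟨ cong (λ t → t * (N ∸ k) ! * (N C k)) (matchings-* α) ⟨
    matchings α * den₁ α * (N ∸ k) ! * (N C k)    ≡⟨ solve 4 (λ m x f c → m :* x :* f :* c := c :* m :* (f :* x)) refl (matchings α) (den₁ α) ((N ∸ k) !) (N C k) ⟩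
    ((N C k) * matchings α) * den₂ n α β            ∎
    where open ≡-Reasoning

term₂≡term : ∀ n α β → 2 * α + β ≤ n → term₂ n α β ≡ term n α β
term₂≡term n α β 2α+β≤n = begin
  (n C β) * ((n ∸ β) ! / den₂ n α β)            ≡⟨ cong ((n C β) *_) ([n∸β]!/den₂≡C*matchings n α β 2α+β≤n) ⟩
  (n C β) * (((n ∸ β) C (2 * α)) * matchings α) ≡⟨ cong₂ (λ x y → x * (y * matchings α)) (C≡choose n β) (C≡choose (n ∸ β) (2 * α)) ⟩
  term n α β                                    ∎
  where
  open ≡-Reasoning
  instance _ = den₂-nonZero n α β

formula₁≡termSum : ∀ n → formula₁ n ≡ termSum n
formula₁≡termSum n = begin
  doubleSum n (term₁ n) ≡⟨ doubleSum-cong n (λ α β _ → term₁≡term n α β) ⟩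
  doubleSum n (term n)  ≡⟨ doubleSum≡rectangle n (term n) (term-vanish n) ⟩
  termSum n             ∎
  where open ≡-Reasoning

formula₁≡formula₂ : ∀ n → formula₁ n ≡ formula₂ n
formula₁≡formula₂ n = doubleSum-cong n (λ α β 2α+β≤n → trans (term₁≡term n α β) (sym (term₂≡term n α β 2α+β≤n)))

corollary6p1 : (n : ℕ) →
    (SkewClan n ↔ Fin (formula₁ n)) × (formula₁ n ≡ formula₂ n)
corollary6p1 n =
  ↔-trans (skewClan↔partialInvolution n)
    (subst (λ k → PartialInvolution n ↔ Fin k) numPartialInvolutions≡formula₁ (partialInvolution↔Fin n))
  , formula₁≡formula₂ n
  where
  numPartialInvolutions≡formula₁ : numPartialInvolutions n ≡ formula₁ n
  numPartialInvolutions≡formula₁ = sym (trans (formula₁≡termSum n) (termSum≡numPartialInvolutions n))
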